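{- Let $f:[n]\to[n]$ be a function, $S\subseteq[n]$, and $d$ a positive integer. There exists a set $\mathcal{A}\subseteq\mathcal{S}_n$ with $|\mathcal{A}|\le d$ that $(S,d)$-covers $f$.
   Context: $[n]=\{1,\dots,n\}$ and $\mathcal{S}_n$ is the set of permutations of $[n]$. For $S\subseteq[n]$ and a positive integer $d$, a set $\mathcal{A}\subseteq\mathcal{S}_n$ is said to $(S,d)$-cover $f:[n]\to[n]$ if for each $r\in S$ at least one of the following holds: (i) there is $\pi\in\mathcal{A}$ with $\pi(r)=f(r)$; or (ii) $|S\cap f^{ -1}(f(r))|>d$. -}

module Defs where

open import Data.Nat using (ℕ; _≤_; _>_; NonZero)
open import Data.Fin using (Fin; _≟_)
open import Data.Fin.Subset using (Subset; _∈_; _∩_; ∣_∣)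
open import Data.Fin.Permutation using (Permutation′; _⟨$⟩ʳ_)
open import Data.Vec using (tabulate)
open import Data.List using (List; length)
open import Data.List.Membership.Propositional renaming (_∈_ to _∈ₗ_)
open import Data.Product using (∃; _×_)
open import Data.Sum using (_⊎_)
open import Relation.Binary.PropositionalEquality using (_≡_)
open import Relation.Nullary.Decidable using (⌊_⌋)

preimage : ∀ {n} → (Fin n → Fin n) → Fin n → Subset n
preimage f y = tabulate (λ i → ⌊ f i ≟ y ⌋)

Covers : ∀ {n} → Subset n → ℕ → List (Permutation′ n) → (Fin n → Fin n) → Set
Covers {n} S d 𝒜 f =
  ∀ (r : Fin n) → r ∈ S →
    (∃ λ π → π ∈ₗ 𝒜 × (π ⟨$⟩ʳ r) ≡ f r)
    ⊎ (∣ S ∩ preimage f (f r) ∣ > d)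

-- Rank each r ∈ S by the number of earlier elements of S in its fibre f⁻¹(f r).
-- Two elements of S with the same rank lie in different fibres, so f is injective
-- on each rank class and extends to a permutation agreeing with f there.  The
-- permutations for ranks 0, …, d − 1 cover every r of rank < d; an r of rank ≥ d
-- has at least d earlier elements of S in its fibre, which therefore has more than d.
module Submission where

open import Defs
open import Data.Nat using (ℕ; _≤_; _>_)
open import Data.Fin using (Fin)
open import Data.Fin.Subset using (Subset)
open import Data.Fin.Permutation using (Permutation′)
open import Data.List using (List; length)
open import Data.Product using (∃; _×_)

open import Level using (Level)
import Data.Nat as ℕ
import Data.Nat.Properties as ℕ
open import Data.Bool.Properties using (T-≡)
open import Data.Fin as Fin using (_≟_; _<_; _<?_)
import Data.Fin.Properties as Fin
open import Data.Fin.Subset using (_∈_; _∉_; _∩_; ∣_∣)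
open import Data.Fin.Subset.Properties using (_∈?_; x∈p∩q⁺; x∈p∩q⁻; p⊂q⇒∣p∣<∣q∣)
open import Data.Fin.Permutation using (_⟨$⟩ʳ_; _⟨$⟩ˡ_; transpose; _∘ₚ_; inverseʳ)
import Data.Fin.Permutation as Permutation
import Data.Fin.Permutation.Components as PC
open import Data.Vec using (tabulate)
open import Data.Vec.Properties using (lookup∘tabulate; lookup⇒[]=; []=⇒lookup)
open import Data.List using ([]; _∷_; allFin; applyUpTo)
open import Data.List.Properties using (length-applyUpTo)
open import Data.List.Membership.Propositional using () renaming (_∈_ to _∈ₗ_)
open import Data.List.Membership.Propositional.Properties using (∈-allFin; ∈-applyUpTo⁺)
open import Data.List.Relation.Unary.Any using (here; there)
open import Data.Product using (_,_; proj₁; proj₂)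
open import Data.Sum using (inj₁; inj₂)
open import Function using (_∘_; case_of_; Equivalence)
open import Relation.Nullary using (yes; no; contradiction)
open import Relation.Nullary.Decidable using (⌊_⌋; isYes≗does; dec-true; dec-false; toWitness; _×-dec_)
open import Relation.Unary using (Pred; Decidable)
open import Relation.Binary using (tri<; tri≈; tri>)
open import Relation.Binary.PropositionalEquality

private
  variable
    ℓ : Level
    n : ℕ

module _ {P : Pred (Fin n) ℓ} (P? : Decidable P) {i : Fin n} where

  ∈-tabulate⌊⌋⁺ : P i → i ∈ tabulate (λ j → ⌊ P? j ⌋)
  ∈-tabulate⌊⌋⁺ Pi = lookup⇒[]= i _
    (trans (lookup∘tabulate _ i) (trans (isYes≗does (P? i)) (dec-true (P? i) Pi)))

  ∈-tabulate⌊⌋⁻ : i ∈ tabulate (λ j → ⌊ P? j ⌋) → P i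
  ∈-tabulate⌊⌋⁻ i∈ = toWitness
    (Equivalence.from T-≡ (trans (sym (lookup∘tabulate _ i)) ([]=⇒lookup i∈)))

transpose-matchˡ : (i j : Fin n) → PC.transpose i j i ≡ j
transpose-matchˡ i j rewrite dec-true (i ≟ i) refl = refl

transpose-fix : (i j k : Fin n) → k ≢ i → k ≢ j → PC.transpose i j k ≡ k
transpose-fix i j k k≢i k≢j rewrite dec-false (k ≟ i) k≢i | dec-false (k ≟ j) k≢j = refl

AgreesOn : Pred (Fin n) ℓ → Permutation′ n → (Fin n → Fin n) → Set ℓ
AgreesOn P π f = ∀ {r} → P r → π ⟨$⟩ʳ r ≡ f r

module _ {P : Pred (Fin n) ℓ} (P? : Decidable P) (f : Fin n → Fin n)
         (injectiveOn : ∀ {r r′} → P r → P r′ → f r ≡ f r′ → r ≡ r′) where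

  private
    redirect : Permutation′ n → Fin n → Permutation′ n
    redirect π x = transpose x (π ⟨$⟩ˡ f x) ∘ₚ π

    redirect-sends : ∀ π x → redirect π x ⟨$⟩ʳ x ≡ f x
    redirect-sends π x = trans (cong (π ⟨$⟩ʳ_) (transpose-matchˡ x _)) (inverseʳ π)

    redirect-keeps : ∀ π {x r} → P x → P r → r ≢ x → π ⟨$⟩ʳ r ≡ f r →
                     redirect π x ⟨$⟩ʳ r ≡ f r
    redirect-keeps π {x} {r} Px Pr r≢x πr≡fr =
      trans (cong (π ⟨$⟩ʳ_) (transpose-fix x _ r r≢x r≢π⁻¹fx)) πr≡fr
      where
      r≢π⁻¹fx : r ≢ π ⟨$⟩ˡ f x
      r≢π⁻¹fx r≡ = r≢x (injectiveOn Pr Px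
        (trans (sym πr≡fr) (trans (cong (π ⟨$⟩ʳ_) r≡) (inverseʳ π))))

    agreesOnList : (L : List (Fin n)) → ∃ λ π → AgreesOn (λ r → r ∈ₗ L × P r) π f
    agreesOnList [] = Permutation.id , λ { (() , _) }
    agreesOnList (x ∷ L) with agreesOnList L | P? x
    ... | π , agrees | no ¬Px = π , λ where
      (here refl , Px) → contradiction Px ¬Px
      (there r∈L , Pr) → agrees (r∈L , Pr)
    ... | π , agrees | yes Px = redirect π x , λ where
      (here refl , _)  → redirect-sends π x
      {r} (there r∈L , Pr) → case r ≟ x of λ where
        (yes refl) → redirect-sends π x
        (no r≢x)   → redirect-keeps π Px Pr r≢x (agrees (r∈L , Pr))

  injectiveOn⇒permutation : ∃ λ π → AgreesOn P π f
  injectiveOn⇒permutation with agreesOnList (allFin n)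
  ... | π , agrees = π , λ {r} Pr → agrees (∈-allFin r , Pr)

below : Fin n → Subset n
below i = tabulate (λ j → ⌊ j <? i ⌋)

i∉below-i : (i : Fin n) → i ∉ below i
i∉below-i i i∈ = Fin.<-irrefl refl (∈-tabulate⌊⌋⁻ (_<? i) i∈)

∣p∩below∣<∣p∣ : ∀ {p : Subset n} {i} → i ∈ p → ∣ p ∩ below i ∣ ℕ.< ∣ p ∣
∣p∩below∣<∣p∣ {p = p} {i} i∈p = p⊂q⇒∣p∣<∣q∣
  ( proj₁ ∘ x∈p∩q⁻ p (below i)
  , i , i∈p , i∉below-i i ∘ proj₂ ∘ x∈p∩q⁻ p (below i))

∣p∩below∣-strictMono : ∀ {p : Subset n} {i j} → i ∈ p → i < j →
                       ∣ p ∩ below i ∣ ℕ.< ∣ p ∩ below j ∣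
∣p∩below∣-strictMono {p = p} {i} {j} i∈p i<j = p⊂q⇒∣p∣<∣q∣
  ( widen
  , i , x∈p∩q⁺ (i∈p , ∈-tabulate⌊⌋⁺ (_<? j) i<j)
  , i∉below-i i ∘ proj₂ ∘ x∈p∩q⁻ p (below i))
  where
  widen : ∀ {k} → k ∈ p ∩ below i → k ∈ p ∩ below j
  widen {k} k∈ with x∈p∩q⁻ p (below i) k∈
  ... | k∈p , k<i = x∈p∩q⁺ (k∈p , ∈-tabulate⌊⌋⁺ (_<? j)
                              (Fin.<-trans (∈-tabulate⌊⌋⁻ (_<? i) k<i) i<j))

module Rank (f : Fin n → Fin n) (S : Subset n) where

  fibre : Fin n → Subset n
  fibre y = S ∩ preimage f y

  rank : Fin n → ℕ
  rank r = ∣ fibre (f r) ∩ below r ∣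

  ∈-fibre : ∀ {r} → r ∈ S → r ∈ fibre (f r)
  ∈-fibre {r} r∈S = x∈p∩q⁺ (r∈S , ∈-tabulate⌊⌋⁺ (λ j → f j ≟ f r) refl)

  rank<∣fibre∣ : ∀ {r} → r ∈ S → rank r ℕ.< ∣ fibre (f r) ∣
  rank<∣fibre∣ = ∣p∩below∣<∣p∣ ∘ ∈-fibre

  rank-strictMono : ∀ {r r′} → r ∈ S → f r ≡ f r′ → r < r′ → rank r ℕ.< rank r′
  rank-strictMono {r} r∈S fr≡fr′ r<r′ rewrite fr≡fr′ =
    ∣p∩below∣-strictMono (subst (λ y → r ∈ fibre y) fr≡fr′ (∈-fibre r∈S)) r<r′

  HasRank : ℕ → Pred (Fin n) _
  HasRank c r = r ∈ S × rank r ≡ c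

  hasRank? : ∀ c → Decidable (HasRank c)
  hasRank? c r = (r ∈? S) ×-dec (rank r ℕ.≟ c)

  f-injectiveOnRank : ∀ c {r r′} → HasRank c r → HasRank c r′ → f r ≡ f r′ → r ≡ r′
  f-injectiveOnRank c {r} {r′} (r∈S , refl) (r′∈S , rank≡) fr≡fr′ with Fin.<-cmp r r′
  ... | tri≈ _ r≡r′ _ = r≡r′
  ... | tri< r<r′ _ _ = contradiction (rank-strictMono r∈S fr≡fr′ r<r′) (ℕ.<-irrefl (sym rank≡))
  ... | tri> _ _ r′<r = contradiction (rank-strictMono r′∈S (sym fr≡fr′) r′<r) (ℕ.<-irrefl rank≡)

  rankPermutation : ℕ → Permutation′ n
  rankPermutation c = proj₁ (injectiveOn⇒permutation (hasRank? c) f (f-injectiveOnRank c))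

  rankPermutation-agrees : ∀ c → AgreesOn (HasRank c) (rankPermutation c) f
  rankPermutation-agrees c = proj₂ (injectiveOn⇒permutation (hasRank? c) f (f-injectiveOnRank c))

  rankPermutations-cover : ∀ d → Covers S d (applyUpTo rankPermutation d) f
  rankPermutations-cover d r r∈S with rank r ℕ.<? d
  ... | yes rank<d = inj₁ ( rankPermutation (rank r) , ∈-applyUpTo⁺ rankPermutation rank<d
                          , rankPermutation-agrees (rank r) (r∈S , refl))
  ... | no rank≮d = inj₂ (ℕ.≤-<-trans (ℕ.≮⇒≥ rank≮d) (rank<∣fibre∣ r∈S))

lemma2p7 : (n : ℕ) (f : Fin n → Fin n) (S : Subset n) (d : ℕ) → d > 0 →
    ∃ λ (𝒜 : List (Permutation′ n)) → length 𝒜 ≤ d × Covers S d 𝒜 f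
lemma2p7 n f S d _ =
  applyUpTo rankPermutation d
  , ℕ.≤-reflexive (length-applyUpTo rankPermutation d)
  , rankPermutations-cover d
  where open Rank f S
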